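{- For all $A,B\subset\mathbb{N}$, $d(\Pr(A),\Pr(B))\le d(A,B)$; that is, the map $\mathcal{P}(\mathbb{N})\ni A\mapsto\Pr(A)\in\mathcal{P}(\mathbb{N})$ is Lipschitz with constant $1$ with respect to $d$.
   Context: For $m\in\mathbb{N}$, $D(m)$ is the set of positive divisors of $m$. For $A\subset\mathbb{N}$, $S_A=\sum_{a\in A}a$ ($S_\emptyset=0$, $S_A=+\infty$ for infinite $A$), and $A$ is a practical set if every non-negative integer $k\le S_A$ is a sum of distinct elements of $A$. A number $m\in\mathbb{N}$ is $A$-practical if $D(m)\cap A$ is a practical set, and $\Pr(A)$ is the set of all $A$-practical numbers. The metric $d$ on $\mathcal{P}(\mathbb{N})$ is $d(A,B)=(\inf(A\div B))^{ -1}$, where $A\div B$ is the symmetric difference, with conventions $\inf\emptyset=+\infty$ and $1/(+\infty)=0$. -}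

module Defs where

open import Data.Bool using (Bool; true; false)
open import Data.Nat using (ℕ; zero; suc; _≤_; _<_)
open import Data.Nat.Divisibility using (_∣?_)
open import Data.List using (List; map; upTo; filter; filterᵇ)
open import Data.Nat.ListAction using (sum)
open import Data.List.Relation.Binary.Sublist.Propositional using (_⊆_)
open import Data.Product using (Σ; _×_)
open import Data.Sum using (_⊎_)
open import Relation.Nullary using (¬_)
open import Relation.Binary.PropositionalEquality using (_≡_)

-- A subset of ℕ = {1,2,3,...} is given by its characteristic function;
-- the value at 0 is irrelevant (0 ∉ ℕ and is ignored everywhere below).
Subset : Set
Subset = ℕ → Bool

D : ℕ → List ℕ
D m = filter (_∣? m) (map suc (upTo m))

D∩ : ℕ → Subset → List ℕ
D∩ m A = filterᵇ A (D m)

-- A finite set X (given as a duplicate-free list) is practical iff every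
-- k ≤ S_X is a sum of distinct elements of X, i.e. the sum of a sub-list.
Practical : List ℕ → Set
Practical X = (k : ℕ) → k ≤ sum X → Σ (List ℕ) (λ Y → (Y ⊆ X) × (sum Y ≡ k))

Pr : Subset → ℕ → Set
Pr A m = (1 ≤ m) × Practical (D∩ m A)

⟦_⟧ : Subset → ℕ → Set
⟦ A ⟧ m = A m ≡ true

SymDiff : (ℕ → Set) → (ℕ → Set) → ℕ → Set
SymDiff P Q m = (P m × ¬ Q m) ⊎ (Q m × ¬ P m)

-- n ≤ inf(P ÷ Q) (inf over positive integers, inf ∅ = +∞):
-- no element m of P ÷ Q with 1 ≤ m < n.
_≤inf÷_,_ : ℕ → (ℕ → Set) → (ℕ → Set) → Set
n ≤inf÷ P , Q = (m : ℕ) → 1 ≤ m → m < n → ¬ SymDiff P Q m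

-- d(P,Q) ≤ d(R,S), where d(X,Y) = 1 / inf(X ÷ Y) ∈ {0} ∪ {1/n : n ≥ 1}.
-- Since d is a decreasing function of inf, this is inf(R ÷ S) ≤ inf(P ÷ Q)
-- in ℕ ∪ {+∞}, i.e. every lower bound n of inf(R ÷ S) is one of inf(P ÷ Q).
d[_,_]≤d[_,_] : (ℕ → Set) → (ℕ → Set) → (ℕ → Set) → (ℕ → Set) → Set
d[ P , Q ]≤d[ R , S ] = (n : ℕ) → n ≤inf÷ R , S → n ≤inf÷ P , Q

module Submission where

open import Defs
open import Data.Bool using (Bool; true; false)
open import Data.Nat using (ℕ; _≤_; _<_; s≤s; z≤n)
open import Data.Nat.Properties using (≤-<-trans)
open import Data.Nat.Divisibility using (_∣?_)
open import Data.List using (List; []; _∷_; filterᵇ)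
open import Data.List.Relation.Unary.All as All using (All; []; _∷_)
open import Data.List.Relation.Unary.All.Properties using (filter⁺; map⁺; all-upTo)
open import Data.Product using (_×_; _,_)
open import Data.Sum using (inj₁; inj₂)
open import Relation.Binary.PropositionalEquality using (_≡_; refl; cong; sym; subst)
open import Relation.Nullary using (¬_)
open import Data.Empty using (⊥-elim)

-- Whether m is A-practical depends only on D(m) ∩ A, and D(m) ⊆ {1, …, m}.
-- So if A and B agree below n = inf(A ÷ B), then Pr(A) and Pr(B) agree below n,
-- i.e. inf(Pr(A) ÷ Pr(B)) ≥ inf(A ÷ B).

filterᵇ-cong : {X : Set} (p q : X → Bool) (xs : List X) →
               All (λ x → p x ≡ q x) xs → filterᵇ p xs ≡ filterᵇ q xs
filterᵇ-cong p q []       []         = refl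
filterᵇ-cong p q (x ∷ xs) (_ ∷ eqs) with p x | q x | filterᵇ-cong p q xs eqs
filterᵇ-cong p q (x ∷ xs) (refl ∷ eqs) | true  | true  | rest = cong (x ∷_) rest
filterᵇ-cong p q (x ∷ xs) (refl ∷ eqs) | false | false | rest = rest

D-bounded : (m : ℕ) → All (λ d → 1 ≤ d × d ≤ m) (D m)
D-bounded m = filter⁺ (_∣? m) (map⁺ (All.map (λ i<m → s≤s z≤n , i<m) (all-upTo m)))

AgreeUpTo : ℕ → Subset → Subset → Set
AgreeUpTo m A B = (d : ℕ) → 1 ≤ d → d ≤ m → A d ≡ B d

AgreeUpTo-sym : {m : ℕ} {A B : Subset} → AgreeUpTo m A B → AgreeUpTo m B A
AgreeUpTo-sym agree d 1≤d d≤m = sym (agree d 1≤d d≤m)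

D∩-cong : (m : ℕ) {A B : Subset} → AgreeUpTo m A B → D∩ m A ≡ D∩ m B
D∩-cong m {A} {B} agree =
  filterᵇ-cong A B (D m) (All.map (λ (1≤d , d≤m) → agree _ 1≤d d≤m) (D-bounded m))

Pr-cong : {m : ℕ} {A B : Subset} → AgreeUpTo m A B → Pr A m → Pr B m
Pr-cong {m} agree (1≤m , practical) = 1≤m , subst Practical (D∩-cong m agree) practical

≡-of-¬SymDiff : (A B : Subset) (d : ℕ) → ¬ SymDiff ⟦ A ⟧ ⟦ B ⟧ d → A d ≡ B d
≡-of-¬SymDiff A B d ¬A÷B with A d | B d
... | true  | true  = refl
... | false | false = refl
... | true  | false = ⊥-elim (¬A÷B (inj₁ (refl , λ ())))
... | false | true  = ⊥-elim (¬A÷B (inj₂ (refl , λ ())))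

agree-below-inf÷ : (A B : Subset) {n m : ℕ} → n ≤inf÷ ⟦ A ⟧ , ⟦ B ⟧ → m < n → AgreeUpTo m A B
agree-below-inf÷ A B n≤inf m<n d 1≤d d≤m = ≡-of-¬SymDiff A B d (n≤inf d 1≤d (≤-<-trans d≤m m<n))

corollary4p11 : (A B : Subset) → d[ Pr A , Pr B ]≤d[ ⟦ A ⟧ , ⟦ B ⟧ ]
corollary4p11 A B n n≤inf m _ m<n (inj₁ (PrA , ¬PrB)) =
  ¬PrB (Pr-cong (agree-below-inf÷ A B n≤inf m<n) PrA)
corollary4p11 A B n n≤inf m _ m<n (inj₂ (PrB , ¬PrA)) =
  ¬PrA (Pr-cong (AgreeUpTo-sym (agree-below-inf÷ A B n≤inf m<n)) PrB)
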